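{- Let $(M,a,b)$ be a special matrix representation of a Lagrangian chain-group $N$ on $V$ to $K=\mathbb{F}^2$. Suppose that $a'$ is a chain with $a'(v)\in\{\pm\binom10,\pm\binom01\}$ for all $v\in V$. Then $a'$ is special eulerian (for $N$) if and only if $M[Y]$ is nonsingular for $Y=\{x\in V: a'(x)\ne\pm a(x)\}$.
   Context: $K=\mathbb{F}^2$ with bilinear form $\langle\,,\,\rangle_K$ equal to $b^+(\binom ab,\binom cd)=ad+bc$ or $b^-(\binom ab,\binom cd)=ad-bc$; chains are maps $V\to K$, $\langle f,g\rangle=\sum_x\langle f(x),g(x)\rangle_K$; chain-groups are subspaces of $K^V$; Lagrangian: totally isotropic of dimension $|V|$. Chains $a,b$ are supplementary if $\langle a(x),a(x)\rangle_K=\langle b(x),b(x)\rangle_K=0$, $\langle a(x),b(x)\rangle_K=1$ for all $x$. For a skew-symmetric ($M=-M^t$, zero diagonal) or symmetric $V\times V$ matrix $M=(m_{ij})$ (with $\langle,\rangle_K$ skew-symmetric if $M$ symmetric, symmetric if $M$ skew-symmetric) and supplementary $a,b$, set $f_i(i)=m_{ii}a(i)+b(i)$, $f_i(j)=m_{ij}a(j)$ for $j\ne i$; if $N$ is the span of the $f_i$, $(M,a,b)$ is a matrix representation of $N$, special if $a(v),b(v)\in\{\pm\binom10,\pm\binom01\}$ for all $v$. A chain $a'$ is eulerian for $N$ if $a'(x)\ne0$, $\langle a'(x),a'(x)\rangle_K=0$ for all $x$, and no nonzero $f\in N$ satisfies $\langle f(x),a'(x)\rangle_K=0$ for all $x$;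 special eulerian if in addition $a'(v)\in\{\pm\binom10,\pm\binom01\}$. $M[\emptyset]$ is regarded as nonsingular. -}

module Defs where

open import Level using (Level; _⊔_)
open import Data.Nat.Base using (ℕ)
open import Data.Fin.Base using (Fin)
import Data.Fin
import Relation.Nullary
import Data.Product.Base
open import Data.Product.Base using (_×_; _,_; Σ; ∃)
open import Data.Sum.Base using (_⊎_)
open import Relation.Nullary using (¬_)
open import Relation.Binary.PropositionalEquality using (_≡_)
open import Algebra.Bundles using (CommutativeRing)
import Algebra.Definitions.RawMonoid as RM

record Field (c ℓ : Level) : Set (Level.suc (c ⊔ ℓ)) where
  field
    commRing : CommutativeRing c ℓ
  open CommutativeRing commRing public
  field
    0≉1      : ¬ (0# ≈ 1#)
    inverse  : ∀ x → ¬ (x ≈ 0#) → Σ Carrier (λ y → x * y ≈ 1#)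

-- The two bilinear forms on K = F²:  b⁺ and b⁻.
data Sign : Set where
  plus minus : Sign

module _ {c ℓ} (F : Field c ℓ) where
  open Field F

  K : Set c
  K = Carrier × Carrier

  _≈K_ : K → K → Set ℓ
  (x , y) ≈K (z , w) = (x ≈ z) × (y ≈ w)

  0K : K
  0K = (0# , 0#)

  negK : K → K
  negK (x , y) = (- x , - y)

  _+K_ : K → K → K
  (x , y) +K (z , w) = (x + z , y + w)

  _·K_ : Carrier → K → K
  r ·K (x , y) = (r * x , r * y)

  formK : Sign → K → K → Carrier
  formK plus  (a , b) (c' , d) = a * d + b * c'
  formK minus (a , b) (c' , d) = a * d - b * c'

  IsSpecialVec : K → Set ℓ
  IsSpecialVec k = (k ≈K (1# , 0#)) ⊎ (k ≈K (- 1# , 0#))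
                 ⊎ (k ≈K (0# , 1#)) ⊎ (k ≈K (0# , - 1#))

  Σ[_] : ∀ {n} → (Fin n → Carrier) → Carrier
  Σ[ f ] = RM.sum +-rawMonoid f

  -- V = Fin n ; chains are maps V → K
  Chain : ℕ → Set c
  Chain n = Fin n → K

  Matrix : ℕ → Set c
  Matrix n = Fin n → Fin n → Carrier

  ⟨_∣_⟩[_] : ∀ {n} → Chain n → Chain n → Sign → Carrier
  ⟨ f ∣ g ⟩[ s ] = Σ[ (λ x → formK s (f x) (g x)) ]

  _≈C_ : ∀ {n} → Chain n → Chain n → Set ℓ
  f ≈C g = ∀ x → f x ≈K g x

  0C : ∀ {n} → Chain n
  0C _ = 0K

  ChainGroup : ℕ → Set (Level.suc (c ⊔ ℓ))
  ChainGroup n = Chain n → Set (c ⊔ ℓ)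

  lincomb : ∀ {n m} → (Fin m → Carrier) → (Fin m → Chain n) → Chain n
  lincomb {m = m} cs fs x =
    (Σ[ (λ i → cs i * Data.Product.Base.proj₁ (fs i x)) ] ,
     Σ[ (λ i → cs i * Data.Product.Base.proj₂ (fs i x)) ])

  Span : ∀ {n m} → (Fin m → Chain n) → ChainGroup n
  Span {m = m} fs f = Σ (Fin m → Carrier) (λ cs → f ≈C lincomb cs fs)

  LinearlyIndependent : ∀ {n m} → (Fin m → Chain n) → Set (c ⊔ ℓ)
  LinearlyIndependent fs = ∀ cs → lincomb cs fs ≈C 0C → ∀ i → cs i ≈ 0#

  HasDimension : ∀ {n} → ChainGroup n → ℕ → Set (c ⊔ ℓ)
  HasDimension {n} N m =
    Σ (Fin m → Chain n) (λ bs →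
      (∀ i → N (bs i)) × LinearlyIndependent bs
      × (∀ f → N f → Span bs f))

  TotallyIsotropic : ∀ {n} → Sign → ChainGroup n → Set (c ⊔ ℓ)
  TotallyIsotropic s N = ∀ f g → N f → N g → ⟨ f ∣ g ⟩[ s ] ≈ 0#

  Lagrangian : ∀ {n} → Sign → ChainGroup n → Set (c ⊔ ℓ)
  Lagrangian {n} s N = TotallyIsotropic s N × HasDimension N n

  Supplementary : ∀ {n} → Sign → Chain n → Chain n → Set ℓ
  Supplementary s a b = ∀ x →
    (formK s (a x) (a x) ≈ 0#) × (formK s (b x) (b x) ≈ 0#)
    × (formK s (a x) (b x) ≈ 1#)

  AdmissibleMatrix : ∀ {n} → Sign → Matrix n → Set ℓ
  AdmissibleMatrix minus M = ∀ i j → M i j ≈ M j i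
  AdmissibleMatrix plus  M = (∀ i j → M i j ≈ - M j i) × (∀ i → M i i ≈ 0#)

  fvec : ∀ {n} → Matrix n → Chain n → Chain n → Fin n → Chain n
  fvec M a b i j with i Data.Fin.≟ j
  ... | Relation.Nullary.yes _ = (M i i ·K a i) +K b i
  ... | Relation.Nullary.no  _ = M i j ·K a j

  MatrixRepresentation : ∀ {n} → Sign → Matrix n → Chain n → Chain n
                         → ChainGroup n → Set (c ⊔ ℓ)
  MatrixRepresentation s M a b N =
    AdmissibleMatrix s M × Supplementary s a b
    × (∀ f → N f → Span (fvec M a b) f) × (∀ f → Span (fvec M a b) f → N f)

  SpecialChain : ∀ {n} → Chain n → Set ℓ
  SpecialChain a = ∀ v → IsSpecialVec (a v)

  SpecialMatrixRepresentation : ∀ {n} → Sign → Matrix n → Chain n → Chain n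
                                → ChainGroup n → Set (c ⊔ ℓ)
  SpecialMatrixRepresentation s M a b N =
    MatrixRepresentation s M a b N × SpecialChain a × SpecialChain b

  Eulerian : ∀ {n} → Sign → ChainGroup n → Chain n → Set (c ⊔ ℓ)
  Eulerian s N a' =
    (∀ x → ¬ (a' x ≈K 0K)) × (∀ x → formK s (a' x) (a' x) ≈ 0#)
    × (∀ f → N f → (∀ x → formK s (f x) (a' x) ≈ 0#) → f ≈C 0C)

  SpecialEulerian : ∀ {n} → Sign → ChainGroup n → Chain n → Set (c ⊔ ℓ)
  SpecialEulerian s N a' = Eulerian s N a' × SpecialChain a'

  Subset : ℕ → Set (Level.suc ℓ)
  Subset n = Fin n → Set ℓ

  -- M[Y] is nonsingular: the only vector u ∈ F^Y with M[Y] u = 0 is u = 0.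
  -- Vectors in F^Y are represented as vectors on V vanishing outside Y.
  -- (For Y = ∅ this holds vacuously, so M[∅] is nonsingular.)
  NonsingularOn : ∀ {n} → Matrix n → Subset n → Set (c ⊔ ℓ)
  NonsingularOn M Y = ∀ (u : Fin _ → Carrier) →
    (∀ j → ¬ Y j → u j ≈ 0#) →
    (∀ i → Y i → Σ[ (λ j → M i j * u j) ] ≈ 0#) →
    ∀ j → u j ≈ 0#

  DiffSet : ∀ {n} → Chain n → Chain n → Subset n
  DiffSet a' a x = ¬ (a' x ≈K a x) × ¬ (a' x ≈K negK (a x))

module Submission where

-- Write f = Σᵢ cᵢ fᵢ for a chain of N.  At a coordinate x,
--   ⟨f(x), w⟩ = (cᵗM)ₓ ⟨a(x), w⟩ + cₓ ⟨b(x), w⟩,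
-- and (cᵗM)ₓ = ±(Mc)ₓ because M is symmetric or skew-symmetric.  Since a(x),
-- b(x) and a'(x) are unit vectors on the two coordinate axes and
-- ⟨a(x),b(x)⟩ = 1, either a'(x) = ±a(x), so ⟨a(x),a'(x)⟩ = 0 ≠ ⟨b(x),a'(x)⟩,
-- or a'(x) lies on the axis of b(x), so ⟨a(x),a'(x)⟩ ≠ 0 = ⟨b(x),a'(x)⟩.
-- Hence f is orthogonal to a' at every coordinate iff c vanishes outside Y
-- and (Mc)ᵢ = 0 for i ∈ Y.  Since the fᵢ are linearly independent,
-- "only f = 0 is orthogonal to a'" says exactly that M[Y] is nonsingular.

open import Defs
open import Level using (_⊔_)
open import Data.Nat.Base using (ℕ; suc)
open import Data.Fin.Base using (Fin; zero; suc)
open import Data.Fin.Properties using (suc-injective)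
import Data.Fin
open import Data.Bool.Base using (Bool; true; false)
open import Data.Bool.Properties using (¬-not) renaming (_≟_ to _≟ᴮ_)
open import Data.Product.Base using (_×_; _,_; proj₁; proj₂)
open import Data.Product.Relation.Binary.Pointwise.NonDependent using (×-setoid)
open import Data.Sum.Base using (_⊎_; inj₁; inj₂)
open import Data.Empty using (⊥-elim)
open import Function.Base using (_∘_)
open import Function.Bundles using (_⇔_; mk⇔; Equivalence)
open import Relation.Binary.Bundles using (Setoid)
open import Relation.Nullary using (¬_; yes; no)
open import Relation.Binary.PropositionalEquality as P using (_≡_; _≢_)
import Algebra.Properties.Ring as RingProperties
import Algebra.Properties.AbelianGroup as AbelianGroupProperties
import Algebra.Properties.CommutativeSemigroup as CommutativeSemigroupProperties
import Algebra.Properties.Semiring.Sum as SumProperties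

open Equivalence using (to; from)

module Development {c ℓ} (F : Field c ℓ) where
  open Field F hiding (zero)
  open RingProperties ring using (-0#≈0#; -‿distribˡ-*; -1*x≈-x; x[y-z]≈xy-xz; -‿involutive)
  open AbelianGroupProperties +-abelianGroup using (⁻¹-∙-comm; ⁻¹-anti-homo‿-)
  open CommutativeSemigroupProperties +-commutativeSemigroup using (interchange)
  open SumProperties semiring using (sum; sum-cong-≋; sum-replicate-zero; *-distribˡ-sum; *-distribʳ-sum)
  open Setoid (×-setoid setoid setoid) public using ()
    renaming (refl to ≈ᴷ-refl; sym to ≈ᴷ-sym; trans to ≈ᴷ-trans)
  open import Relation.Binary.Reasoning.Setoid setoid

  cancelʳ : ∀ {x y} → ¬ (y ≈ 0#) → x * y ≈ 0# → x ≈ 0#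
  cancelʳ {x} {y} y≉0 xy≈0 with inverse y y≉0
  ... | y⁻¹ , yy⁻¹≈1 = begin
    x              ≈⟨ *-identityʳ x ⟨
    x * 1#         ≈⟨ *-congˡ yy⁻¹≈1 ⟨
    x * (y * y⁻¹)  ≈⟨ *-assoc x y y⁻¹ ⟨
    (x * y) * y⁻¹  ≈⟨ *-congʳ xy≈0 ⟩
    0# * y⁻¹       ≈⟨ zeroˡ y⁻¹ ⟩
    0#             ∎

  ±-vanishes : ∀ {x y} → (x ≈ y) ⊎ (x ≈ - y) → (x ≈ 0# ⇔ y ≈ 0#)
  ±-vanishes (inj₁ x≈y) = mk⇔ (trans (sym x≈y)) (trans x≈y)
  ±-vanishes {x} {y} (inj₂ x≈-y) = mk⇔
    (λ x≈0 → trans (sym (-‿involutive y)) (trans (-‿cong (trans (sym x≈-y) x≈0)) -0#≈0#))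
    (λ y≈0 → trans x≈-y (trans (-‿cong y≈0) -0#≈0#))

  -- If y vanishes and w does not, then x·y + z·w vanishes exactly when z does.
  -- This is how one coordinate of ⟨f(x), a'(x)⟩ is read off.
  vanishes-by-right : ∀ {x y z w} → y ≈ 0# → ¬ (w ≈ 0#) → (x * y + z * w ≈ 0# ⇔ z ≈ 0#)
  vanishes-by-right {x} {y} {z} {w} y≈0 w≉0 = mk⇔
    (λ sum≈0 → cancelʳ w≉0 (trans (sym drop-left) sum≈0))
    (λ z≈0 → trans drop-left (trans (*-congʳ z≈0) (zeroˡ w)))
    where
    drop-left : x * y + z * w ≈ z * w
    drop-left = trans (+-congʳ (trans (*-congˡ y≈0) (zeroʳ x))) (+-identityˡ (z * w))

  vanishes-by-left : ∀ {x y z w} → ¬ (y ≈ 0#) → w ≈ 0# → (x * y + z * w ≈ 0# ⇔ x ≈ 0#)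
  vanishes-by-left {x} {y} {z} {w} y≉0 w≈0 = mk⇔
    (to swapped ∘ trans (+-comm (z * w) (x * y)))
    (trans (+-comm (x * y) (z * w)) ∘ from swapped)
    where
    swapped : z * w + x * y ≈ 0# ⇔ x ≈ 0#
    swapped = vanishes-by-right w≈0 y≉0

  IsUnit : Carrier → Set ℓ
  IsUnit e = (e ≈ 1#) ⊎ (e ≈ - 1#)

  unit-nonzero : ∀ {e} → IsUnit e → ¬ (e ≈ 0#)
  unit-nonzero (inj₁ e≈1) e≈0 = 0≉1 (trans (sym e≈0) e≈1)
  unit-nonzero (inj₂ e≈-1) e≈0 = 0≉1 (sym (to (±-vanishes (inj₂ e≈-1)) e≈0))

  units-differ-by-sign : ∀ {e e'} → IsUnit e → IsUnit e' → (e ≈ e') ⊎ (e ≈ - e')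
  units-differ-by-sign (inj₁ e≈1) (inj₁ e'≈1) = inj₁ (trans e≈1 (sym e'≈1))
  units-differ-by-sign (inj₁ e≈1) (inj₂ e'≈-1) =
    inj₂ (trans e≈1 (trans (sym (-‿involutive 1#)) (-‿cong (sym e'≈-1))))
  units-differ-by-sign (inj₂ e≈-1) (inj₁ e'≈1) = inj₂ (trans e≈-1 (-‿cong (sym e'≈1)))
  units-differ-by-sign (inj₂ e≈-1) (inj₂ e'≈-1) = inj₁ (trans e≈-1 (sym e'≈-1))

  sum-vanishes : ∀ {n} (g : Fin n → Carrier) → (∀ i → g i ≈ 0#) → sum g ≈ 0#
  sum-vanishes {n} g g≈0 = trans (sum-cong-≋ g≈0) (sum-replicate-zero n)

  sum-neg : ∀ {n} (g : Fin n → Carrier) → sum (λ i → - g i) ≈ - sum g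
  sum-neg g = begin
    sum (λ i → - g i)      ≈⟨ sum-cong-≋ (λ i → -1*x≈-x (g i)) ⟨
    sum (λ i → - 1# * g i) ≈⟨ *-distribˡ-sum (- 1#) g ⟨
    - 1# * sum g           ≈⟨ -1*x≈-x (sum g) ⟩
    - sum g                ∎

  sum-perturb : ∀ {n} (g p : Fin n → Carrier) q (x : Fin n) →
    (∀ i → i ≢ x → g i ≈ p i) → g x ≈ p x + q → sum g ≈ sum p + q
  sum-perturb {suc n} g p q zero off on = begin
    g zero + sum (g ∘ suc)        ≈⟨ +-cong on (sum-cong-≋ (λ i → off (suc i) λ ())) ⟩
    (p zero + q) + sum (p ∘ suc)  ≈⟨ +-assoc (p zero) q _ ⟩
    p zero + (q + sum (p ∘ suc))  ≈⟨ +-congˡ (+-comm q _) ⟩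
    p zero + (sum (p ∘ suc) + q)  ≈⟨ +-assoc (p zero) _ q ⟨
    sum p + q                     ∎
  sum-perturb {suc n} g p q (suc x) off on = trans
    (+-cong (off zero λ ())
            (sum-perturb (g ∘ suc) (p ∘ suc) q x (λ i i≢x → off (suc i) (i≢x ∘ suc-injective)) on))
    (sym (+-assoc _ _ q))

  -- The i-th entry (Mu)ᵢ of M u, as in the definition of nonsingularity, and
  -- the x-th entry (cᵗM)ₓ of cᵗ M, which arises when expanding Σᵢ cᵢ fᵢ.
  rowSum : ∀ {n} → Matrix F n → (Fin n → Carrier) → Fin n → Carrier
  rowSum M u i = sum (λ j → M i j * u j)

  colSum : ∀ {n} → Matrix F n → (Fin n → Carrier) → Fin n → Carrier
  colSum M c x = sum (λ i → c i * M i x)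

  colSum≈±rowSum : ∀ s {n} (M : Matrix F n) → AdmissibleMatrix F s M → ∀ c x →
    (colSum M c x ≈ rowSum M c x) ⊎ (colSum M c x ≈ - rowSum M c x)
  colSum≈±rowSum minus M symmetric c x =
    inj₁ (sum-cong-≋ (λ i → trans (*-comm (c i) _) (*-congʳ (symmetric i x))))
  colSum≈±rowSum plus M (skew , _) c x = inj₂ (trans (sum-cong-≋ entry) (sum-neg (λ j → M x j * c j)))
    where
    entry : ∀ i → c i * M i x ≈ - (M x i * c i)
    entry i = trans (*-comm (c i) _) (trans (*-congʳ (skew i x)) (sym (-‿distribˡ-* _ _)))

  colSum-vanishes⇔ : ∀ s {n} (M : Matrix F n) → AdmissibleMatrix F s M → ∀ c x →
    colSum M c x ≈ 0# ⇔ rowSum M c x ≈ 0#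
  colSum-vanishes⇔ s M adm c x = ±-vanishes (colSum≈±rowSum s M adm c x)

  SupportedOn : ∀ {n} → (Fin n → Carrier) → Subset F n → Set ℓ
  SupportedOn u Y = ∀ j → ¬ Y j → u j ≈ 0#

  AnnihilatedOn : ∀ {n} → Matrix F n → (Fin n → Carrier) → Subset F n → Set ℓ
  AnnihilatedOn M u Y = ∀ i → Y i → rowSum M u i ≈ 0#

  _≈ᴷ_ : K F → K F → Set ℓ
  _≈ᴷ_ = _≈K_ F

  ⟪_⟫ : Sign → K F → K F → Carrier
  ⟪ s ⟫ = formK F s

  form-cong : ∀ s {u u' v v'} → u ≈ᴷ u' → v ≈ᴷ v' → ⟪ s ⟫ u v ≈ ⟪ s ⟫ u' v'
  form-cong plus (u₁ , u₂) (v₁ , v₂) = +-cong (*-cong u₁ v₂) (*-cong u₂ v₁)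
  form-cong minus (u₁ , u₂) (v₁ , v₂) = +-cong (*-cong u₁ v₂) (-‿cong (*-cong u₂ v₁))

  form-zeroˡ : ∀ s w → ⟪ s ⟫ (0K F) w ≈ 0#
  form-zeroˡ plus w = trans (+-cong (zeroˡ _) (zeroˡ _)) (+-identityˡ 0#)
  form-zeroˡ minus w = trans (+-cong (zeroˡ _) (trans (-‿cong (zeroˡ _)) -0#≈0#)) (+-identityˡ 0#)

  form-+ˡ : ∀ s u v w → ⟪ s ⟫ (_+K_ F u v) w ≈ ⟪ s ⟫ u w + ⟪ s ⟫ v w
  form-+ˡ plus u v w =
    trans (+-cong (distribʳ _ _ _) (distribʳ _ _ _)) (interchange _ _ _ _)
  form-+ˡ minus u v w = trans
    (+-cong (distribʳ _ _ _) (trans (-‿cong (distribʳ _ _ _)) (sym (⁻¹-∙-comm _ _))))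
    (interchange _ _ _ _)

  form-·ˡ : ∀ s r u w → ⟪ s ⟫ (_·K_ F r u) w ≈ r * ⟪ s ⟫ u w
  form-·ˡ plus r u w =
    trans (+-cong (*-assoc r _ _) (*-assoc r _ _)) (sym (distribˡ r _ _))
  form-·ˡ minus r u w =
    trans (+-cong (*-assoc r _ _) (-‿cong (*-assoc r _ _))) (sym (x[y-z]≈xy-xz r _ _))

  form-swap : ∀ s u v → (⟪ s ⟫ v u ≈ ⟪ s ⟫ u v) ⊎ (⟪ s ⟫ v u ≈ - ⟪ s ⟫ u v)
  form-swap plus (u₁ , u₂) (v₁ , v₂) =
    inj₁ (trans (+-comm _ _) (+-cong (*-comm v₂ u₁) (*-comm v₁ u₂)))
  form-swap minus (u₁ , u₂) (v₁ , v₂) =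
    inj₂ (sym (trans (⁻¹-anti-homo‿- _ _) (+-cong (*-comm u₂ v₁) (-‿cong (*-comm u₁ v₂)))))

  onAxis : Bool → Carrier → K F
  onAxis true e = (e , 0#)
  onAxis false e = (0# , e)

  record AxisForm (k : K F) : Set (c ⊔ ℓ) where
    constructor axisForm
    field
      axis  : Bool
      coeff : Carrier
      unit  : IsUnit coeff
      shape : k ≈ᴷ onAxis axis coeff

  special⇒axisForm : ∀ {k} → IsSpecialVec F k → AxisForm k
  special⇒axisForm (inj₁ k≈) = axisForm true 1# (inj₁ refl) k≈
  special⇒axisForm (inj₂ (inj₁ k≈)) = axisForm true (- 1#) (inj₂ refl) k≈
  special⇒axisForm (inj₂ (inj₂ (inj₁ k≈))) = axisForm false 1# (inj₁ refl) k≈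
  special⇒axisForm (inj₂ (inj₂ (inj₂ k≈))) = axisForm false (- 1#) (inj₂ refl) k≈

  Parallel : K F → K F → Set ℓ
  Parallel k A = (k ≈ᴷ A) ⊎ (k ≈ᴷ negK F A)

  Apart : K F → K F → Set ℓ
  Apart k A = ¬ (k ≈ᴷ A) × ¬ (k ≈ᴷ negK F A)

  negK-cong : ∀ {u v} → u ≈ᴷ v → negK F u ≈ᴷ negK F v
  negK-cong (u₁≈v₁ , u₂≈v₂) = -‿cong u₁≈v₁ , -‿cong u₂≈v₂

  parallel-resp : ∀ {k k' A A'} → k ≈ᴷ k' → A ≈ᴷ A' → Parallel k' A' → Parallel k A
  parallel-resp k≈ A≈ (inj₁ k'≈A') = inj₁ (≈ᴷ-trans k≈ (≈ᴷ-trans k'≈A' (≈ᴷ-sym A≈)))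
  parallel-resp k≈ A≈ (inj₂ k'≈-A') =
    inj₂ (≈ᴷ-trans k≈ (≈ᴷ-trans k'≈-A' (negK-cong (≈ᴷ-sym A≈))))

  apart-resp : ∀ {k k' A A'} → k ≈ᴷ k' → A ≈ᴷ A' → Apart k' A' → Apart k A
  apart-resp k≈ A≈ (k'≉A' , k'≉-A') =
    (λ k≈A → k'≉A' (≈ᴷ-trans (≈ᴷ-sym k≈) (≈ᴷ-trans k≈A A≈))) ,
    (λ k≈-A → k'≉-A' (≈ᴷ-trans (≈ᴷ-sym k≈) (≈ᴷ-trans k≈-A (negK-cong A≈))))

  parallel⇒¬apart : ∀ {k A} → Parallel k A → ¬ Apart k A
  parallel⇒¬apart (inj₁ k≈A) (k≉A , _) = k≉A k≈A
  parallel⇒¬apart (inj₂ k≈-A) (_ , k≉-A) = k≉-A k≈-A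

  onAxis-nonzero : ∀ t {e} → ¬ (e ≈ 0#) → ¬ (onAxis t e ≈ᴷ 0K F)
  onAxis-nonzero true e≉0 (e≈0 , _) = e≉0 e≈0
  onAxis-nonzero false e≉0 (_ , e≈0) = e≉0 e≈0

  same-axis-parallel : ∀ t {e e'} → IsUnit e → IsUnit e' → Parallel (onAxis t e) (onAxis t e')
  same-axis-parallel t ue ue' with units-differ-by-sign ue ue' | t
  ... | inj₁ e≈e' | true = inj₁ (e≈e' , refl)
  ... | inj₁ e≈e' | false = inj₁ (refl , e≈e')
  ... | inj₂ e≈-e' | true = inj₂ (e≈-e' , sym -0#≈0#)
  ... | inj₂ e≈-e' | false = inj₂ (sym -0#≈0# , e≈-e')

  other-axis-apart : ∀ {t t' e e'} → t ≢ t' → ¬ (e ≈ 0#) → Apart (onAxis t e) (onAxis t' e')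
  other-axis-apart {true} {true} t≢t' _ = ⊥-elim (t≢t' P.refl)
  other-axis-apart {false} {false} t≢t' _ = ⊥-elim (t≢t' P.refl)
  other-axis-apart {true} {false} _ e≉0 =
    (λ (e≈0 , _) → e≉0 e≈0) , (λ (e≈-0 , _) → e≉0 (trans e≈-0 -0#≈0#))
  other-axis-apart {false} {true} _ e≉0 =
    (λ (_ , e≈0) → e≉0 e≈0) , (λ (_ , e≈-0) → e≉0 (trans e≈-0 -0#≈0#))

  form-same-axis : ∀ s t e e' → ⟪ s ⟫ (onAxis t e) (onAxis t e') ≈ 0#
  form-same-axis plus true e e' = trans (+-cong (zeroʳ e) (zeroˡ e')) (+-identityˡ 0#)
  form-same-axis plus false e e' = trans (+-cong (zeroˡ e') (zeroʳ e)) (+-identityˡ 0#)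
  form-same-axis minus true e e' =
    trans (+-cong (zeroʳ e) (trans (-‿cong (zeroˡ e')) -0#≈0#)) (+-identityˡ 0#)
  form-same-axis minus false e e' =
    trans (+-cong (zeroˡ e') (trans (-‿cong (zeroʳ e)) -0#≈0#)) (+-identityˡ 0#)

  form-other-axis : ∀ s {t t' e e'} → t ≢ t' →
    (⟪ s ⟫ (onAxis t e) (onAxis t' e') ≈ e * e') ⊎ (⟪ s ⟫ (onAxis t e) (onAxis t' e') ≈ - (e * e'))
  form-other-axis s {true} {true} t≢t' = ⊥-elim (t≢t' P.refl)
  form-other-axis s {false} {false} t≢t' = ⊥-elim (t≢t' P.refl)
  form-other-axis plus {true} {false} _ = inj₁ (trans (+-congˡ (zeroˡ 0#)) (+-identityʳ _))
  form-other-axis plus {false} {true} _ = inj₁ (trans (+-congʳ (zeroˡ 0#)) (+-identityˡ _))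
  form-other-axis minus {true} {false} _ =
    inj₁ (trans (+-congˡ (trans (-‿cong (zeroˡ 0#)) -0#≈0#)) (+-identityʳ _))
  form-other-axis minus {false} {true} _ = inj₂ (trans (+-congʳ (zeroˡ 0#)) (+-identityˡ _))

  form-other-axis-nonzero : ∀ s {t t' e e'} → t ≢ t' → ¬ (e ≈ 0#) → ¬ (e' ≈ 0#) →
    ¬ (⟪ s ⟫ (onAxis t e) (onAxis t' e') ≈ 0#)
  form-other-axis-nonzero s {e = e} {e'} t≢t' e≉0 e'≉0 form≈0 =
    e'≉0 (cancelʳ e≉0 (trans (*-comm e' e) (to (±-vanishes (form-other-axis s t≢t')) form≈0)))

  data Position (s : Sign) (A B k : K F) : Set ℓ where
    parallel   : Parallel k A → ⟪ s ⟫ A k ≈ 0# → ¬ (⟪ s ⟫ B k ≈ 0#) → Position s A B k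
    transverse : Apart k A → ¬ (⟪ s ⟫ A k ≈ 0#) → ⟪ s ⟫ B k ≈ 0# → Position s A B k

  position : ∀ s {A B k} → AxisForm A → AxisForm B → AxisForm k → ⟪ s ⟫ A B ≈ 1# →
    Position s A B k
  position s (axisForm tA eA uA A≈) (axisForm tB eB uB B≈) (axisForm tk ek uk k≈) ⟨A,B⟩≈1
    with tB ≟ᴮ tA | tk ≟ᴮ tA
  ... | yes P.refl | _ =
    ⊥-elim (0≉1 (trans (sym (trans (form-cong s A≈ B≈) (form-same-axis s tA eA eB))) ⟨A,B⟩≈1))
  ... | no tB≢tA | yes P.refl =
    parallel
      (parallel-resp k≈ A≈ (same-axis-parallel tA uk uA))
      (trans (form-cong s A≈ k≈) (form-same-axis s tA eA ek))
      (form-other-axis-nonzero s tB≢tA (unit-nonzero uB) (unit-nonzero uk)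
        ∘ trans (sym (form-cong s B≈ k≈)))
  ... | no tB≢tA | no tk≢tA with P.trans (¬-not tk≢tA) (P.sym (¬-not tB≢tA))
  ... | P.refl =
    transverse
      (apart-resp k≈ A≈ (other-axis-apart tk≢tA (unit-nonzero uk)))
      (form-other-axis-nonzero s (tk≢tA ∘ P.sym) (unit-nonzero uA) (unit-nonzero uk)
        ∘ trans (sym (form-cong s A≈ k≈)))
      (trans (form-cong s B≈ k≈) (form-same-axis s tk eB ek))

  fvec-off : ∀ {n} (M : Matrix F n) (a b : Chain F n) i x → i ≢ x →
    fvec F M a b i x ≡ _·K_ F (M i x) (a x)
  fvec-off M a b i x i≢x with i Data.Fin.≟ x
  ... | yes i≡x = ⊥-elim (i≢x i≡x)
  ... | no _ = P.refl

  fvec-diag : ∀ {n} (M : Matrix F n) (a b : Chain F n) x →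
    fvec F M a b x x ≡ _+K_ F (_·K_ F (M x x) (a x)) (b x)
  fvec-diag M a b x with x Data.Fin.≟ x
  ... | yes _ = P.refl
  ... | no x≢x = ⊥-elim (x≢x P.refl)

  column-sum : ∀ {n} (M : Matrix F n) (c : Fin n → Carrier) x α β (g : Fin n → Carrier) →
    (∀ i → i ≢ x → g i ≈ M i x * α) → g x ≈ M x x * α + β →
    sum (λ i → c i * g i) ≈ colSum M c x * α + c x * β
  column-sum M c x α β g off on = begin
    sum (λ i → c i * g i)
      ≈⟨ sum-perturb _ (λ i → (c i * M i x) * α) (c x * β) x off′ on′ ⟩
    sum (λ i → (c i * M i x) * α) + c x * β
      ≈⟨ +-congʳ (*-distribʳ-sum α (λ i → c i * M i x)) ⟨
    colSum M c x * α + c x * β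
      ∎
    where
    off′ : ∀ i → i ≢ x → c i * g i ≈ (c i * M i x) * α
    off′ i i≢x = trans (*-congˡ (off i i≢x)) (sym (*-assoc _ _ _))
    on′ : c x * g x ≈ (c x * M x x) * α + c x * β
    on′ = trans (*-congˡ on) (trans (distribˡ _ _ _) (+-congʳ (sym (*-assoc _ _ _))))

  lincomb-coordinate : ∀ {n} (M : Matrix F n) (a b : Chain F n) c x →
    lincomb F c (fvec F M a b) x ≈ᴷ _+K_ F (_·K_ F (colSum M c x) (a x)) (_·K_ F (c x) (b x))
  lincomb-coordinate M a b c x =
    column-sum M c x _ _ (λ i → proj₁ (fvec F M a b i x))
      (λ i i≢x → reflexive (P.cong proj₁ (fvec-off M a b i x i≢x)))
      (reflexive (P.cong proj₁ (fvec-diag M a b x))) ,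
    column-sum M c x _ _ (λ i → proj₂ (fvec F M a b i x))
      (λ i i≢x → reflexive (P.cong proj₂ (fvec-off M a b i x i≢x)))
      (reflexive (P.cong proj₂ (fvec-diag M a b x)))

  form-lincomb : ∀ s {n} (M : Matrix F n) (a b : Chain F n) c x w →
    ⟪ s ⟫ (lincomb F c (fvec F M a b) x) w ≈ colSum M c x * ⟪ s ⟫ (a x) w + c x * ⟪ s ⟫ (b x) w
  form-lincomb s M a b c x w = begin
    ⟪ s ⟫ (lincomb F c (fvec F M a b) x) w
      ≈⟨ form-cong s (lincomb-coordinate M a b c x) ≈ᴷ-refl ⟩
    ⟪ s ⟫ (_+K_ F (_·K_ F (colSum M c x) (a x)) (_·K_ F (c x) (b x))) w
      ≈⟨ form-+ˡ s _ _ w ⟩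
    ⟪ s ⟫ (_·K_ F (colSum M c x) (a x)) w + ⟪ s ⟫ (_·K_ F (c x) (b x)) w
      ≈⟨ +-cong (form-·ˡ s _ (a x) w) (form-·ˡ s _ (b x) w) ⟩
    colSum M c x * ⟪ s ⟫ (a x) w + c x * ⟪ s ⟫ (b x) w
      ∎

  lincomb-vanishes : ∀ {n} (fs : Fin n → Chain F n) c →
    (∀ i → c i ≈ 0#) → _≈C_ F (lincomb F c fs) (0C F)
  lincomb-vanishes fs c c≈0 x =
    sum-vanishes _ (λ i → trans (*-congʳ (c≈0 i)) (zeroˡ _)) ,
    sum-vanishes _ (λ i → trans (*-congʳ (c≈0 i)) (zeroˡ _))

  -- For supplementary a, b the chains fᵢ are linearly independent: pairing
  -- coordinate j of Σᵢ cᵢ fᵢ with a(j) leaves cⱼ ⟨b(j),a(j)⟩ = ±cⱼ.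
  fvec-independent : ∀ s {n} (M : Matrix F n) (a b : Chain F n) →
    Supplementary F s a b → LinearlyIndependent F (fvec F M a b)
  fvec-independent s M a b supp c combination≈0 j =
    to (vanishes-by-right (proj₁ (supp j)) ⟨b,a⟩≉0)
       (trans (sym (form-lincomb s M a b c j (a j)))
              (trans (form-cong s (combination≈0 j) ≈ᴷ-refl) (form-zeroˡ s (a j))))
    where
    ⟨b,a⟩≉0 : ¬ (⟪ s ⟫ (b j) (a j) ≈ 0#)
    ⟨b,a⟩≉0 ⟨b,a⟩≈0 =
      0≉1 (trans (sym (to (±-vanishes (form-swap s (a j) (b j))) ⟨b,a⟩≈0)) (proj₂ (proj₂ (supp j))))

  orthogonal-at : ∀ s {n} (M : Matrix F n) (a b : Chain F n) → AdmissibleMatrix F s M →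
    ∀ c x {k} → Position s (a x) (b x) k →
    ⟪ s ⟫ (lincomb F c (fvec F M a b) x) k ≈ 0#
      ⇔ ((¬ Apart k (a x) → c x ≈ 0#) × (Apart k (a x) → rowSum M c x ≈ 0#))
  orthogonal-at s M a b adm c x {k} (parallel k∥a ⟨a,k⟩≈0 ⟨b,k⟩≉0) = mk⇔
    (λ orth → (λ _ → to criterion orth) , (⊥-elim ∘ parallel⇒¬apart k∥a))
    (λ (cₓ≈0 , _) → from criterion (cₓ≈0 (parallel⇒¬apart k∥a)))
    where
    criterion : ⟪ s ⟫ (lincomb F c (fvec F M a b) x) k ≈ 0# ⇔ c x ≈ 0#
    criterion = mk⇔
      (to (vanishes-by-right ⟨a,k⟩≈0 ⟨b,k⟩≉0) ∘ trans (sym (form-lincomb s M a b c x k)))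
      (trans (form-lincomb s M a b c x k) ∘ from (vanishes-by-right ⟨a,k⟩≈0 ⟨b,k⟩≉0))
  orthogonal-at s M a b adm c x {k} (transverse apart ⟨a,k⟩≉0 ⟨b,k⟩≈0) = mk⇔
    (λ orth → (λ notApart → ⊥-elim (notApart apart)) , (λ _ → to criterion orth))
    (λ (_ , rowₓ≈0) → from criterion (rowₓ≈0 apart))
    where
    criterion : ⟪ s ⟫ (lincomb F c (fvec F M a b) x) k ≈ 0# ⇔ rowSum M c x ≈ 0#
    criterion = mk⇔
      (to (colSum-vanishes⇔ s M adm c x) ∘ to (vanishes-by-left ⟨a,k⟩≉0 ⟨b,k⟩≈0)
        ∘ trans (sym (form-lincomb s M a b c x k)))
      (trans (form-lincomb s M a b c x k) ∘ from (vanishes-by-left ⟨a,k⟩≉0 ⟨b,k⟩≈0)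
        ∘ from (colSum-vanishes⇔ s M adm c x))

  orthogonality-criterion : ∀ s {n} (M : Matrix F n) (a b a' : Chain F n) →
    AdmissibleMatrix F s M → (∀ x → Position s (a x) (b x) (a' x)) → ∀ c →
    (∀ x → ⟪ s ⟫ (lincomb F c (fvec F M a b) x) (a' x) ≈ 0#)
      ⇔ (SupportedOn c (DiffSet F a' a) × AnnihilatedOn M c (DiffSet F a' a))
  orthogonality-criterion s M a b a' adm pos c = mk⇔
    (λ orth → (λ j → proj₁ (to (local j) (orth j))) , (λ i → proj₂ (to (local i) (orth i))))
    (λ (supported , annihilated) x → from (local x) (supported x , annihilated x))
    where
    local : ∀ x → ⟪ s ⟫ (lincomb F c (fvec F M a b) x) (a' x) ≈ 0#
      ⇔ ((¬ Apart (a' x) (a x) → c x ≈ 0#) × (Apart (a' x) (a x) → rowSum M c x ≈ 0#))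
    local x = orthogonal-at s M a b adm c x (pos x)

  special-position : ∀ s {n} {a b a' : Chain F n} → Supplementary F s a b →
    SpecialChain F a → SpecialChain F b → SpecialChain F a' →
    ∀ x → Position s (a x) (b x) (a' x)
  special-position s supp special-a special-b special-a' x =
    position s (special⇒axisForm (special-a x)) (special⇒axisForm (special-b x))
               (special⇒axisForm (special-a' x)) (proj₂ (proj₂ (supp x)))

  special-nonzero : ∀ {n} {a' : Chain F n} → SpecialChain F a' → ∀ x → ¬ (a' x ≈ᴷ 0K F)
  special-nonzero special-a' x a'ₓ≈0 with special⇒axisForm (special-a' x)
  ... | axisForm t e unit shape = onAxis-nonzero t (unit-nonzero unit) (≈ᴷ-trans (≈ᴷ-sym shape) a'ₓ≈0)

  special-isotropic : ∀ s {n} {a' : Chain F n} → SpecialChain F a' → ∀ x → ⟪ s ⟫ (a' x) (a' x) ≈ 0#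
  special-isotropic s special-a' x with special⇒axisForm (special-a' x)
  ... | axisForm t e _ shape = trans (form-cong s shape shape) (form-same-axis s t e e)

proposition4p4 : ∀ {c ℓ} (F : Field c ℓ) (s : Sign) (n : ℕ)
    (N : ChainGroup F n) (M : Matrix F n) (a b a' : Chain F n) →
    Lagrangian F s N →
    SpecialMatrixRepresentation F s M a b N →
    SpecialChain F a' →
    (SpecialEulerian F s N a' ⇔ NonsingularOn F M (DiffSet F a' a))
proposition4p4 F s n N M a b a' _ ((adm , supp , N⊆span , span⊆N) , special-a , special-b) special-a' =
  mk⇔ eulerian⇒nonsingular nonsingular⇒eulerian
  where
  open Development F
  open Field F using (_≈_; 0#; trans)

  criterion : ∀ c → (∀ x → ⟪ s ⟫ (lincomb F c (fvec F M a b) x) (a' x) ≈ 0#)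
    ⇔ (SupportedOn c (DiffSet F a' a) × AnnihilatedOn M c (DiffSet F a' a))
  criterion = orthogonality-criterion s M a b a' adm (special-position s supp special-a special-b special-a')

  -- A vector u witnessing singularity of M[Y] gives Σᵢ uᵢ fᵢ ∈ N orthogonal to a'.
  eulerian⇒nonsingular : SpecialEulerian F s N a' → NonsingularOn F M (DiffSet F a' a)
  eulerian⇒nonsingular ((_ , _ , only-zero-orthogonal) , _) u supported annihilated =
    fvec-independent s M a b supp u
      (only-zero-orthogonal _ (span⊆N _ (u , λ _ → ≈ᴷ-refl))
        (from (criterion u) (supported , annihilated)))

  -- A chain f = Σᵢ cᵢ fᵢ of N orthogonal to a' has c = 0 by nonsingularity.
  nonsingular⇒eulerian : NonsingularOn F M (DiffSet F a' a) → SpecialEulerian F s N a'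
  nonsingular⇒eulerian nonsingular =
    (special-nonzero special-a' , special-isotropic s special-a' , only-zero-orthogonal) , special-a'
    where
    only-zero-orthogonal : ∀ f → N f → (∀ x → ⟪ s ⟫ (f x) (a' x) ≈ 0#) → _≈C_ F f (0C F)
    only-zero-orthogonal f f∈N orth with N⊆span f f∈N
    ... | c , f≈Σcf = λ x → ≈ᴷ-trans (f≈Σcf x) (lincomb-vanishes (fvec F M a b) c c≈0 x)
      where
      Σcf-orth : ∀ x → ⟪ s ⟫ (lincomb F c (fvec F M a b) x) (a' x) ≈ 0#
      Σcf-orth x = trans (form-cong s (≈ᴷ-sym (f≈Σcf x)) ≈ᴷ-refl) (orth x)
      c≈0 : ∀ i → c i ≈ 0#
      c≈0 = nonsingular c (proj₁ (to (criterion c) Σcf-orth)) (proj₂ (to (criterion c) Σcf-orth))
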